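{- Let $C$ be a single-sorted $<\kappa$-ary clone and $(e_s)_{s\in S}$ a family of idempotent elements of $C_1$. Let $d=(e_s\circ\pi_{(S\times S,(s,s))}/\sim_S)_{s\in S}$ and, for $s\in S$, $\tilde e_s=(e_t\circ\pi_{(S,s)}/\sim_1)_{t\in S}$. Then $d$ and the $\tilde e_s$ are elements of $\boxtimes_{s\in S}e_s(C)$ (of sorts $S$ and $1$ respectively), and $(d,(\tilde e_s)_{s\in S})$ is an $S$-ary diagonal pair of $\boxtimes_{s\in S}e_s(C)$.
   Context: $S$ is a nonzero cardinal (identified with the set of smaller ordinals) and $\kappa>S$ infinite. A single-sorted $<\kappa$-ary clone $C$ consists of sets $C_\lambda$ ($\lambda<\kappa$; sets of size $<\kappa$ such as $\lambda\times S$ may serve as arities), projections $\pi_{(\lambda,i)}\in C_\lambda$ and associative compositions $(f,(g_i)_{i\in\lambda_1})\mapsto f\circ(g_i)_i$ with projections as units. $e\in C_1$ is idempotent if $e\circ e=e$. The matrix product clone $\boxtimes_{s\in S}e_s(C)$ has as sort $\lambda$ the tuples $(f_s/\sim_\lambda)_{s\in S}$ with $f_s\in C_{\lambda\times S}$, $e_s\circ f_s=f_s$, where $f\sim_\lambda g$ iff $f\circ(e_t\circ\pi_{(\lambda\times S,(i,t))})_{(i,t)}=g\circ(e_t\circ\pi_{(\lambda\times S,(i,t))})_{(i,t)}$; projections $\pi_{(\lambda,i)}=(e_s\circ\pi_{(\lambda\times S,(i,s))}/\sim)_s$; composition $(f_s/\sim)_s\circ((g_{i,t}/\sim)_t)_{i\in\lambda_1}=(f_s\circ(g_{i,t})_{(i,t)}/\sim)_s$.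 An $S$-ary diagonal pair of a single-sorted clone $D$ is $(d,(e_s)_{s\in S})$, $d\in D_S$, $e_s\in D_1$, with (1) $e_s\circ d=e_s\circ\pi_{(S,s)}$ for all $s$; (2) $d\circ(e_s\circ\pi_{(S,s)})_{s\in S}=d$; (3) $d\circ(\pi_{(S,0)})_{s\in S}=\pi_{(S,0)}$. -}

module Defs where

open import Level using (Level; _⊔_) renaming (suc to lsuc; zero to lzero)
open import Data.Unit using (⊤; tt)
open import Data.Product using (Σ; _×_; _,_; proj₁; proj₂)
open import Relation.Binary using (IsEquivalence)

-- For the paper's setting take Small = "has cardinality < κ" (κ infinite);
-- it contains ⊤ (= the cardinal 1) and is closed under binary products.
record Arities : Set₁ where
  field
    Small   : Set → Set
    ⊤-small : Small ⊤
    ×-small : ∀ {A B} → Small A → Small B → Small (A × B)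

module _ {𝔸 : Arities} where
  open Arities 𝔸

  record Arity : Set₁ where
    constructor ar
    field
      El    : Set
      small : Small El
  open Arity public

  𝟙 : Arity
  𝟙 = ar ⊤ ⊤-small

  _⊗_ : Arity → Arity → Arity
  A ⊗ B = ar (El A × El B) (×-small (small A) (small B))

  record RawClone (c ℓ : Level) : Set (lsuc (c ⊔ ℓ)) where
    infix 4 _≈_
    infixr 9 _∘_
    field
      Op  : Arity → Set c
      _≈_ : ∀ {A} → Op A → Op A → Set ℓ
      π   : ∀ {A} → El A → Op A
      _∘_ : ∀ {A B} → Op A → (El A → Op B) → Op B

  record IsClone {c ℓ} (R : RawClone c ℓ) : Set (lsuc (c ⊔ ℓ)) where
    open RawClone R
    field
      isEquivalence : ∀ {A} → IsEquivalence (_≈_ {A})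
      ∘-cong  : ∀ {A B} {f f' : Op A} {g g' : El A → Op B} →
                f ≈ f' → (∀ i → g i ≈ g' i) → f ∘ g ≈ f' ∘ g'
      assoc   : ∀ {A B D} (f : Op A) (g : El A → Op B) (h : El B → Op D) →
                (f ∘ g) ∘ h ≈ f ∘ (λ i → g i ∘ h)
      π-unitˡ : ∀ {A B} (i : El A) (g : El A → Op B) → π {A} i ∘ g ≈ g i
      π-unitʳ : ∀ {A} (f : Op A) → f ∘ π ≈ f

  record Clone (c ℓ : Level) : Set (lsuc (c ⊔ ℓ)) where
    field
      raw     : RawClone c ℓ
      isClone : IsClone raw
    open RawClone raw public
    open IsClone isClone public

  IsIdempotent : ∀ {c ℓ} (C : RawClone c ℓ) → RawClone.Op C 𝟙 → Set ℓ
  IsIdempotent C e = e ∘ (λ _ → e) ≈ e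
    where open RawClone C

  -- S-ary diagonal pair (d , (e_s)_s) of a clone D; s₀ is the element 0 of S.
  record IsDiagonalPair {c ℓ} (D : RawClone c ℓ) (S : Arity) (s₀ : El S)
                        (d : RawClone.Op D S) (e : El S → RawClone.Op D 𝟙)
                        : Set ℓ where
    open RawClone D
    field
      cond1 : ∀ s → e s ∘ (λ _ → d) ≈ e s ∘ (λ _ → π s)
      cond2 : d ∘ (λ s → e s ∘ (λ _ → π s)) ≈ d
      cond3 : d ∘ (λ _ → π {S} s₀) ≈ π {S} s₀

  module MatrixProduct {c ℓ} (C : Clone c ℓ) (S : Arity)
                       (e : El S → Clone.Op C 𝟙)
                       (idem : ∀ s → IsIdempotent (Clone.raw C) (e s)) where
    open Clone C
    private
      module E {A} = IsEquivalence (isEquivalence {A})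

    IsElem : (L : Arity) → (El S → Op (L ⊗ S)) → Set ℓ
    IsElem L f = ∀ s → e s ∘ (λ _ → f s) ≈ f s

    Elem : Arity → Set (c ⊔ ℓ)
    Elem L = Σ (El S → Op (L ⊗ S)) (IsElem L)

    _∼_ : ∀ {L : Arity} → Op (L ⊗ S) → Op (L ⊗ S) → Set ℓ
    _∼_ {L} f g = f ∘ (λ it → e (proj₂ it) ∘ (λ _ → π {L ⊗ S} it))
          ≈ g ∘ (λ it → e (proj₂ it) ∘ (λ _ → π {L ⊗ S} it))

    private
      π-elem : ∀ {L} (i : El L) → IsElem L (λ s → e s ∘ (λ _ → π (i , s)))
      π-elem i s = E.trans (E.sym (assoc (e s) (λ _ → e s) (λ _ → π (i , s))))
                           (∘-cong (idem s) (λ _ → E.refl))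

      ∘-elem : ∀ {A B} (f : Elem A) (g : El A → Elem B) →
               IsElem B (λ s → proj₁ f s ∘ (λ it → proj₁ (g (proj₁ it)) (proj₂ it)))
      ∘-elem f g s = E.trans (E.sym (assoc (e s) (λ _ → proj₁ f s) _))
                             (∘-cong (proj₂ f s) (λ _ → E.refl))

    ⊠ : RawClone (c ⊔ ℓ) ℓ
    ⊠ = record
      { Op  = Elem
      ; _≈_ = λ f g → ∀ s → proj₁ f s ∼ proj₁ g s
      ; π   = λ i → (λ s → e s ∘ (λ _ → π (i , s))) , π-elem i
      ; _∘_ = λ f g → (λ s → proj₁ f s ∘ (λ it → proj₁ (g (proj₁ it)) (proj₂ it)))
                      , ∘-elem f g
      }

    diag : El S → Op (S ⊗ S)
    diag s = e s ∘ (λ _ → π (s , s))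

    -- ẽ_s = (e_t ∘ π_{(S,s)} / ∼_1)_t   (sort 1; 1 × S is identified with S)
    ẽ : El S → El S → Op (𝟙 ⊗ S)
    ẽ s t = e t ∘ (λ _ → π (tt , s))

module Submission where

open import Defs
open import Level using (Level)
open import Data.Product using (Σ; _,_)
open import Data.Unit using (tt)
open import Relation.Binary using (Setoid; IsEquivalence)
import Relation.Binary.Reasoning.Setoid as SetoidReasoning

-- Each axiom of a diagonal pair holds in ⊠ already before passing to ∼:
-- after composing, a unary e t ∘ π i only picks out the i-th argument, and
-- idempotency of the e t absorbs the repeated factors.

module CloneProperties {𝔸 : Arities} {c ℓ : Level} (C : Clone {𝔸} c ℓ) where
  open Clone C

  setoid : Arity {𝔸} → Setoid c ℓ
  setoid A = record { isEquivalence = isEquivalence {A} }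

  module ≈ {A} = IsEquivalence (isEquivalence {A})

  ∘-π-∘ : ∀ A {B} (h : Op 𝟙) (i : El A) (g : El A → Op B) →
          (h ∘ (λ _ → π {A} i)) ∘ g ≈ h ∘ (λ _ → g i)
  ∘-π-∘ A h i g = ≈.trans (assoc h (λ _ → π {A} i) g) (∘-cong ≈.refl (λ _ → π-unitˡ {A} i g))

  idempotent-absorbˡ : ∀ {e : Op 𝟙} → IsIdempotent raw e → ∀ {B} (x : Op B) →
                       e ∘ (λ _ → e ∘ (λ _ → x)) ≈ e ∘ (λ _ → x)
  idempotent-absorbˡ {e} idem x =
    ≈.trans (≈.sym (assoc e (λ _ → e) (λ _ → x))) (∘-cong idem (λ _ → ≈.refl))

module _ {𝔸 : Arities} {c ℓ : Level} (C : Clone {𝔸} c ℓ) (S : Arity {𝔸})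
         (e : El S → Clone.Op C 𝟙)
         (idem : ∀ s → IsIdempotent (Clone.raw C) (e s)) where
  open Clone C
  open CloneProperties C
  open MatrixProduct C S e idem

  ≈⇒∼ : ∀ {L} {f g : Op (L ⊗ S)} → f ≈ g → f ∼ g
  ≈⇒∼ f≈g = ∘-cong f≈g (λ _ → ≈.refl)

  diag-isElem : IsElem S diag
  diag-isElem s = idempotent-absorbˡ (idem s) (π (s , s))

  ẽ-isElem : ∀ s → IsElem 𝟙 (ẽ s)
  ẽ-isElem s t = idempotent-absorbˡ (idem t) (π (tt , s))

  private
    d : RawClone.Op ⊠ S
    d = diag , diag-isElem

    ẽ⊠ : El S → RawClone.Op ⊠ 𝟙
    ẽ⊠ s = ẽ s , ẽ-isElem s

  open RawClone ⊠ using () renaming (_∘_ to _⊙_; π to π⊠; _≈_ to _≋_)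

  ẽ⊙diag≋ẽ⊙π : ∀ s → ẽ⊠ s ⊙ (λ _ → d) ≋ ẽ⊠ s ⊙ (λ _ → π⊠ s)
  ẽ⊙diag≋ẽ⊙π s t = ≈⇒∼ (≈.trans (∘-π-∘ (𝟙 ⊗ S) (e t) (tt , s) _) (≈.sym (∘-π-∘ (𝟙 ⊗ S) (e t) (tt , s) _)))

  diag⊙ẽ⊙π≋diag : d ⊙ (λ s → ẽ⊠ s ⊙ (λ _ → π⊠ s)) ≋ d
  diag⊙ẽ⊙π≋diag s = ≈⇒∼ (begin
    diag s ∘ _                                     ≈⟨ ∘-π-∘ (S ⊗ S) (e s) (s , s) _ ⟩
    e s ∘ (λ _ → ẽ s s ∘ π-row s)                  ≈⟨ ∘-cong ≈.refl (λ _ → ẽ∘π-row≈diag) ⟩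
    e s ∘ (λ _ → diag s)                           ≈⟨ diag-isElem s ⟩
    diag s                                         ∎)
    where
    open SetoidReasoning (setoid (S ⊗ S))
    π-row : El S → El (𝟙 ⊗ S) → Op (S ⊗ S)
    π-row i (_ , t) = e t ∘ (λ _ → π (i , t))
    ẽ∘π-row≈diag : ẽ s s ∘ π-row s ≈ diag s
    ẽ∘π-row≈diag = ≈.trans (∘-π-∘ (𝟙 ⊗ S) (e s) (tt , s) _) (diag-isElem s)

  diag⊙π≋π : ∀ s₀ → d ⊙ (λ _ → π⊠ {S} s₀) ≋ π⊠ {S} s₀
  diag⊙π≋π s₀ s = ≈⇒∼ (≈.trans (∘-π-∘ (S ⊗ S) (e s) (s , s) _) (idempotent-absorbˡ (idem s) (π (s₀ , s))))

  diag-isDiagonalPair : ∀ s₀ → IsDiagonalPair ⊠ S s₀ d ẽ⊠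
  diag-isDiagonalPair s₀ = record
    { cond1 = ẽ⊙diag≋ẽ⊙π
    ; cond2 = diag⊙ẽ⊙π≋diag
    ; cond3 = diag⊙π≋π s₀
    }

proposition4p4 : {c ℓ : Level} (𝔸 : Arities) (C : Clone {𝔸} c ℓ) (S : Arity {𝔸})
                 (s₀ : El S) (e : El S → Clone.Op C 𝟙)
                 (idem : ∀ s → IsIdempotent (Clone.raw C) (e s)) →
                 Σ (MatrixProduct.IsElem C S e idem S (MatrixProduct.diag C S e idem)) λ dm →
                 Σ (∀ s → MatrixProduct.IsElem C S e idem 𝟙 (MatrixProduct.ẽ C S e idem s)) λ em →
                 IsDiagonalPair (MatrixProduct.⊠ C S e idem) S s₀
                   (MatrixProduct.diag C S e idem , dm)
                   (λ s → MatrixProduct.ẽ C S e idem s , em s)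
proposition4p4 𝔸 C S s₀ e idem =
  diag-isElem C S e idem , ẽ-isElem C S e idem , diag-isDiagonalPair C S e idem s₀
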